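{- $\vdash_{\mathsf{R}'_{\mathrm{BK}}}\;\subseteq\;\vdash_{\mathrm{BK}}$; that is, for all formulas $\Gamma\cup\{\varphi\}$, if $\Gamma\vdash_{\mathsf{R}'_{\mathrm{BK}}}\varphi$ then $\Gamma\vdash_{\mathrm{BK}}\varphi$.
   Context: $L$: formulas over a countably infinite set of variables with binary $\land,\lor$ and unary $\neg$. $\mathbf A$: algebra on $\{f,u,t\}$ whose connectives act classically ($f$ false, $t$ true) on $\{f,t\}$-arguments and return $u$ whenever some argument is $u$. $\Gamma\vdash_{\mathrm{BK}}\varphi$ iff there is no homomorphism $v$ into $\mathbf A$ with $v[\Gamma]\subseteq\{t\}$ and $v(\varphi)\ne t$. Set-Fmla Hilbert systems: rule schemas $\gamma_1,\dots,\gamma_m/\varphi$ with all substitution instances; $\Gamma\vdash_{\mathsf R}\varphi$ iff some finite sequence ending in $\varphi$ has each member in $\Gamma$ or the conclusion of a rule instance whose premises occur earlier. The $\lor$-lifted version of a rule $\gamma_1,\dots,\gamma_m/\varphi$ is $s\lor\gamma_1,\dots,s\lor\gamma_m/s\lor\varphi$ with $s$ a variable not occurring in the rule. $\mathsf{R}'_{\mathrm{BK}}$ has rule schemas ($p,q,r$ distinct): (1$\star$) $p,\neg p/q$; (2) $p/\neg\neg p$; (3) $\neg\neg p/p$; (4) $p,q/p\land q$; (5) $\neg p,\neg q/\neg(p\land q)$; (6) $\neg p,q/\neg(p\land q)$; (7) $p,\neg q/\neg(p\land q)$; (8$\star$) $\neg(p\land q)/\neg p\lor p$; (9$\star$) $\neg(p\land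 q)/\neg q\lor q$; (10) $p\land q/p$; (11) $p\land q/q$; (12) $\neg p,\neg q/\neg(p\lor q)$; (13) $\neg(p\lor q)/\neg p$; (14) $\neg(p\lor q)/\neg q$; (15$\star$) $p\lor q/p\lor\neg p$; (16$\star$) $p\lor q/q\lor\neg q$; (17) $\neg p,q/p\lor q$; (18) $p,\neg q/p\lor q$; (19) $p,q/p\lor q$; (20) $p\lor q,\neg p/q$; (21) $p\lor(q\lor r)/(p\lor q)\lor r$; (22) $p\lor p/p$; (23) $p\lor q/q\lor p$; (24) $p\lor q,r/\neg p\lor r$; plus the $\lor$-lifted versions of all these except (1$\star$). -}

module Defs where

open import Data.Nat using (ℕ)
open import Data.List using (List; []; _∷_; map)
open import Data.List.Relation.Unary.All using (All)
open import Data.List.Relation.Unary.Any using (Any)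
open import Data.List.Membership.Propositional using (_∈_)
open import Data.Product using (Σ; ∃; _×_; _,_)
open import Data.Sum using (_⊎_)
open import Data.Empty using (⊥)
open import Relation.Binary.PropositionalEquality using (_≡_; _≢_)
open import Relation.Nullary using (¬_)

data Fm : Set where
  var : ℕ → Fm
  _∧_ : Fm → Fm → Fm
  _∨_ : Fm → Fm → Fm
  ¬′  : Fm → Fm

infixr 6 _∧_
infixr 5 _∨_

Fms : Set₁
Fms = Fm → Set

data V3 : Set where
  f u t : V3

neg3 : V3 → V3
neg3 f = t
neg3 u = u
neg3 t = f

and3 : V3 → V3 → V3
and3 u _ = u
and3 _ u = u
and3 t t = t
and3 t f = f
and3 f t = f
and3 f f = f

or3 : V3 → V3 → V3
or3 u _ = u
or3 _ u = u
or3 f f = f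
or3 f t = t
or3 t f = t
or3 t t = t

-- homomorphisms L → A are exactly extensions of valuations of the variables
⟦_⟧ : Fm → (ℕ → V3) → V3
⟦ var n ⟧ ρ = ρ n
⟦ φ ∧ ψ ⟧ ρ = and3 (⟦ φ ⟧ ρ) (⟦ ψ ⟧ ρ)
⟦ φ ∨ ψ ⟧ ρ = or3 (⟦ φ ⟧ ρ) (⟦ ψ ⟧ ρ)
⟦ ¬′ φ ⟧ ρ = neg3 (⟦ φ ⟧ ρ)

_⊢BK_ : Fms → Fm → Set
Γ ⊢BK φ = ¬ (Σ (ℕ → V3) λ ρ → ((γ : Fm) → Γ γ → ⟦ γ ⟧ ρ ≡ t) × (⟦ φ ⟧ ρ ≢ t))

infix 3 _/_

record Rule : Set where
  constructor _/_
  field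
    prems : List Fm
    concl : Fm

_[_] : Fm → (ℕ → Fm) → Fm
var n [ σ ] = σ n
(φ ∧ ψ) [ σ ] = (φ [ σ ]) ∧ (ψ [ σ ])
(φ ∨ ψ) [ σ ] = (φ [ σ ]) ∨ (ψ [ σ ])
¬′ φ [ σ ] = ¬′ (φ [ σ ])

-- a derivation (read from the end: head is the last formula) of a
-- finite sequence in which each member is in Γ or is the conclusion of
-- a substitution instance of a rule of R whose premises occur earlier
data IsDerivation (R : List Rule) (Γ : Fms) : List Fm → Set where
  []   : IsDerivation R Γ []
  hyp  : ∀ {φ ds} → IsDerivation R Γ ds → Γ φ → IsDerivation R Γ (φ ∷ ds)
  rule : ∀ {ds} (r : Rule) (σ : ℕ → Fm) → r ∈ R →
         IsDerivation R Γ ds →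
         All (λ γ → (γ [ σ ]) ∈ ds) (Rule.prems r) →
         IsDerivation R Γ ((Rule.concl r [ σ ]) ∷ ds)

_⊢[_]_ : Fms → List Rule → Fm → Set
Γ ⊢[ R ] φ = Σ (List Fm) λ ds → IsDerivation R Γ (φ ∷ ds)

p q r s : Fm
p = var 0
q = var 1
r = var 2
s = var 3   -- does not occur in any base rule (which use only p, q, r)

lift : Rule → Rule
lift (γs / φ) = map (s ∨_) γs / (s ∨ φ)

liftable : List Rule
liftable =
    (p ∷ [] / ¬′ (¬′ p))
  ∷ (¬′ (¬′ p) ∷ [] / p)
  ∷ (p ∷ q ∷ [] / (p ∧ q))
  ∷ (¬′ p ∷ ¬′ q ∷ [] / ¬′ (p ∧ q))
  ∷ (¬′ p ∷ q ∷ [] / ¬′ (p ∧ q))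
  ∷ (p ∷ ¬′ q ∷ [] / ¬′ (p ∧ q))
  ∷ (¬′ (p ∧ q) ∷ [] / (¬′ p ∨ p))
  ∷ (¬′ (p ∧ q) ∷ [] / (¬′ q ∨ q))
  ∷ ((p ∧ q) ∷ [] / p)
  ∷ ((p ∧ q) ∷ [] / q)
  ∷ (¬′ p ∷ ¬′ q ∷ [] / ¬′ (p ∨ q))
  ∷ (¬′ (p ∨ q) ∷ [] / ¬′ p)
  ∷ (¬′ (p ∨ q) ∷ [] / ¬′ q)
  ∷ ((p ∨ q) ∷ [] / (p ∨ ¬′ p))
  ∷ ((p ∨ q) ∷ [] / (q ∨ ¬′ q))
  ∷ (¬′ p ∷ q ∷ [] / (p ∨ q))
  ∷ (p ∷ ¬′ q ∷ [] / (p ∨ q))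
  ∷ (p ∷ q ∷ [] / (p ∨ q))
  ∷ ((p ∨ q) ∷ ¬′ p ∷ [] / q)
  ∷ ((p ∨ (q ∨ r)) ∷ [] / ((p ∨ q) ∨ r))
  ∷ ((p ∨ p) ∷ [] / p)
  ∷ ((p ∨ q) ∷ [] / (q ∨ p))
  ∷ ((p ∨ q) ∷ r ∷ [] / (¬′ p ∨ r))
  ∷ []

R'BK : List Rule
R'BK = (p ∷ ¬′ p ∷ [] / q)
     ∷ (liftable Data.List.++ map lift liftable)

{-# OPTIONS --safe #-}
-- Every rule of R'BK preserves the designated value t under every valuation
-- in A; since its rules mention only the variables p, q, r, s, this is a
-- finite check over the 3⁴ values of those variables.  A substitution
-- instance of a rule is evaluated under ρ exactly as the rule itself is under
-- the composed valuation n ↦ ⟦ σ n ⟧ ρ, so by induction every member of a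
-- derivation from premises true under ρ is itself true under ρ.
module Submission where

open import Defs
open import Data.Nat using (ℕ; zero; suc; _<_; _<?_; s≤s)
open import Data.List using (List; []; _∷_)
open import Data.List.Relation.Unary.All as All using (All; []; _∷_; all?)
open import Data.Vec using (Vec; []; _∷_)
open import Data.Product using (_×_; _,_)
open import Relation.Nullary using (Dec; yes; no)
open import Relation.Nullary.Decidable using (map′; _×-dec_; _→-dec_; from-yes)
open import Relation.Binary.PropositionalEquality using (_≡_; refl; cong; cong₂; trans; sym)

infix 4 _⊨_

_⊨_ : (ℕ → V3) → Fm → Set
ρ ⊨ φ = ⟦ φ ⟧ ρ ≡ t

_⊨?_ : (ρ : ℕ → V3) (φ : Fm) → Dec (ρ ⊨ φ)
ρ ⊨? φ with ⟦ φ ⟧ ρ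
... | f = no λ ()
... | u = no λ ()
... | t = yes refl

⟦⟧-[] : ∀ φ σ ρ → ⟦ φ [ σ ] ⟧ ρ ≡ ⟦ φ ⟧ (λ n → ⟦ σ n ⟧ ρ)
⟦⟧-[] (var n) σ ρ = refl
⟦⟧-[] (φ ∧ ψ) σ ρ = cong₂ and3 (⟦⟧-[] φ σ ρ) (⟦⟧-[] ψ σ ρ)
⟦⟧-[] (φ ∨ ψ) σ ρ = cong₂ or3 (⟦⟧-[] φ σ ρ) (⟦⟧-[] ψ σ ρ)
⟦⟧-[] (¬′ φ) σ ρ = cong neg3 (⟦⟧-[] φ σ ρ)

VarsBelow : ℕ → Fm → Set
VarsBelow k (var n) = n < k
VarsBelow k (φ ∧ ψ) = VarsBelow k φ × VarsBelow k ψ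
VarsBelow k (φ ∨ ψ) = VarsBelow k φ × VarsBelow k ψ
VarsBelow k (¬′ φ) = VarsBelow k φ

varsBelow? : ∀ k φ → Dec (VarsBelow k φ)
varsBelow? k (var n) = n <? k
varsBelow? k (φ ∧ ψ) = varsBelow? k φ ×-dec varsBelow? k ψ
varsBelow? k (φ ∨ ψ) = varsBelow? k φ ×-dec varsBelow? k ψ
varsBelow? k (¬′ φ) = varsBelow? k φ

⟦⟧-coincidence : ∀ {k ρ ρ′} → (∀ {n} → n < k → ρ n ≡ ρ′ n) →
                 ∀ φ → VarsBelow k φ → ⟦ φ ⟧ ρ ≡ ⟦ φ ⟧ ρ′
⟦⟧-coincidence agree (var n) n<k = agree n<k
⟦⟧-coincidence agree (φ ∧ ψ) (bφ , bψ) =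
  cong₂ and3 (⟦⟧-coincidence agree φ bφ) (⟦⟧-coincidence agree ψ bψ)
⟦⟧-coincidence agree (φ ∨ ψ) (bφ , bψ) =
  cong₂ or3 (⟦⟧-coincidence agree φ bφ) (⟦⟧-coincidence agree ψ bψ)
⟦⟧-coincidence agree (¬′ φ) bφ = cong neg3 (⟦⟧-coincidence agree φ bφ)

-- The value f beyond the end of the vector is arbitrary.
valuation : ∀ {k} → Vec V3 k → ℕ → V3
valuation [] _ = f
valuation (a ∷ v) zero = a
valuation (a ∷ v) (suc n) = valuation v n

restrict : ∀ k → (ℕ → V3) → Vec V3 k
restrict zero ρ = []
restrict (suc k) ρ = ρ 0 ∷ restrict k (λ n → ρ (suc n))

valuation-restrict : ∀ {k n} ρ → n < k → valuation (restrict k ρ) n ≡ ρ n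
valuation-restrict {suc k} {zero} ρ _ = refl
valuation-restrict {suc k} {suc n} ρ (s≤s n<k) = valuation-restrict (λ m → ρ (suc m)) n<k

∀-V3? : {P : V3 → Set} → (∀ a → Dec (P a)) → Dec (∀ a → P a)
∀-V3? P? = map′ (λ { (pf , pu , pt) → λ { f → pf ; u → pu ; t → pt } })
                (λ all → all f , all u , all t)
                (P? f ×-dec P? u ×-dec P? t)

∀-Vec? : ∀ k {P : Vec V3 k → Set} → (∀ v → Dec (P v)) → Dec (∀ v → P v)
∀-Vec? zero P? = map′ (λ { p [] → p }) (λ all → all []) (P? [])
∀-Vec? (suc k) P? = map′ (λ { all (a ∷ v) → all a v }) (λ all a v → all (a ∷ v))
                         (∀-V3? λ a → ∀-Vec? k λ v → P? (a ∷ v))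

open Rule

TruthPreserving : (ℕ → V3) → Rule → Set
TruthPreserving ρ r = All (ρ ⊨_) (prems r) → ρ ⊨ concl r

truthPreserving? : ∀ ρ r → Dec (TruthPreserving ρ r)
truthPreserving? ρ r = all? (ρ ⊨?_) (prems r) →-dec ρ ⊨? concl r

Sound : Rule → Set
Sound r = ∀ ρ → TruthPreserving ρ r

RuleVarsBelow : ℕ → Rule → Set
RuleVarsBelow k r = All (VarsBelow k) (prems r) × VarsBelow k (concl r)

ruleVarsBelow? : ∀ k r → Dec (RuleVarsBelow k r)
ruleVarsBelow? k r = all? (varsBelow? k) (prems r) ×-dec varsBelow? k (concl r)

SoundBelow : ℕ → Rule → Set
SoundBelow k r = ∀ (v : Vec V3 k) → TruthPreserving (valuation v) r

soundBelow? : ∀ k r → Dec (SoundBelow k r)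
soundBelow? k r = ∀-Vec? k λ v → truthPreserving? (valuation v) r

soundBelow⇒sound : ∀ {k} r → RuleVarsBelow k r → SoundBelow k r → Sound r
soundBelow⇒sound {k} r (bprems , bconcl) soundBelow ρ ρ⊨prems =
  trans (⟦⟧-coincidence agree (concl r) bconcl) (soundBelow v v⊨prems)
  where
  v : Vec V3 k
  v = restrict k ρ
  agree : ∀ {n} → n < k → ρ n ≡ valuation v n
  agree n<k = sym (valuation-restrict ρ n<k)
  v⊨prems : All (valuation v ⊨_) (prems r)
  v⊨prems = All.zipWith (λ { {γ} (bγ , ρ⊨γ) → trans (sym (⟦⟧-coincidence agree γ bγ)) ρ⊨γ })
                        (bprems , ρ⊨prems)

R'BK-sound : All Sound R'BK
R'BK-sound = All.map (λ { {r} (bounded , soundBelow) → soundBelow⇒sound r bounded soundBelow })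
                     (from-yes (all? (λ r → ruleVarsBelow? 4 r ×-dec soundBelow? 4 r) R'BK))

module _ {R : List Rule} (R-sound : All Sound R) {Γ : Fms} {ρ : ℕ → V3}
         (ρ⊨Γ : ∀ γ → Γ γ → ρ ⊨ γ) where

  derivation-true : ∀ {ds} → IsDerivation R Γ ds → All (ρ ⊨_) ds
  derivation-true [] = []
  derivation-true (hyp {γ} d γ∈Γ) = ρ⊨Γ γ γ∈Γ ∷ derivation-true d
  derivation-true (rule {ds} r σ r∈R d instances) =
    trans (⟦⟧-[] (concl r) σ ρ) (All.lookup R-sound r∈R ρσ ρσ⊨prems) ∷ ρ⊨ds
    where
    ρ⊨ds : All (ρ ⊨_) ds
    ρ⊨ds = derivation-true d
    ρσ : ℕ → V3
    ρσ n = ⟦ σ n ⟧ ρ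
    ρσ⊨prems : All (ρσ ⊨_) (prems r)
    ρσ⊨prems = All.map (λ {γ} γσ∈ds → trans (sym (⟦⟧-[] γ σ ρ)) (All.lookup ρ⊨ds γσ∈ds)) instances

soundness : ∀ {R Γ φ} → All Sound R → Γ ⊢[ R ] φ → Γ ⊢BK φ
soundness R-sound (ds , d) (ρ , ρ⊨Γ , ρ⊭φ) = ρ⊭φ (All.head (derivation-true R-sound ρ⊨Γ d))

lemma2 : (Γ : Fms) (φ : Fm) → Γ ⊢[ R'BK ] φ → Γ ⊢BK φ
lemma2 Γ φ = soundness R'BK-sound
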